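{- Let $\mathbf A=(A;\wedge,d)$ be an SMB algebra over the congruence ${\sim}$, not necessarily finite. Then there are terms $d'(x,y,z)$ and $x\wedge' y$ of $\mathbf A$ such that $\mathbf A'=(A;\wedge',d')$ is an SMB algebra over the same congruence ${\sim}$ which satisfies conditions (i)–(iii) below, and $d'(a,b,c)=d(a,b,c)$ whenever $a,b,c$ lie in the same ${\sim}$-class. Conditions: (i) $[d'(a,b,c)]_{\sim}=[(a\wedge' b)\wedge' c]_{\sim}$ for all $a,b,c\in A$; (ii) $a\wedge' b=b$ for all $a,b\in A$ with $[a]_{\sim}\ge[b]_{\sim}$; (iii) $\mathbf A'\models d'(x,y,z)\approx d'((y\wedge' z)\wedge' x,(x\wedge' z)\wedge' y,(x\wedge' y)\wedge' z)$.
   Context: An algebra $\mathbf A=(A;\wedge,d)$ is idempotent if $x\wedge x=x$ and $d(x,x,x)=x$ for all $x$. For a congruence ${\sim}$ of $\mathbf A$, $\mathbf A$ is an SMB algebra over ${\sim}$ if it is idempotent, $(A/{\sim};\wedge)$ is a semilattice, and on each ${\sim}$-class $\wedge$ acts as the second projection and $d$ acts as a Mal'cev operation ($d(x,y,y)=x=d(y,y,x)$). The order on $A/{\sim}$ is the semilattice order: $[u]_{\sim}\le[v]_{\sim}$ iff $[u]_{\sim}\wedge[v]_{\sim}=[u]_{\sim}$ (the same order arises from $\wedge'$). -}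

module Defs where

open import Level using (Level; _⊔_)
open import Data.Nat using (ℕ)
open import Data.Fin using (Fin; zero; suc)
open import Data.Product using (_×_)
open import Relation.Binary.Core using (Rel)
open import Relation.Binary.PropositionalEquality using (_≡_)
open import Algebra.Core using (Op₂)
open import Algebra.Lattice.Structures using (IsSemilattice)

Op₃ : ∀ {a} → Set a → Set a
Op₃ A = A → A → A → A

data Term (n : ℕ) : Set where
  var  : Fin n → Term n
  meet : Term n → Term n → Term n
  dd   : Term n → Term n → Term n → Term n

⟦_⟧ : ∀ {a} {A : Set a} {n : ℕ} → Term n → Op₂ A → Op₃ A → (Fin n → A) → A
⟦ var i ⟧ _∧_ d ρ = ρ i
⟦ meet s t ⟧ _∧_ d ρ = ⟦ s ⟧ _∧_ d ρ ∧ ⟦ t ⟧ _∧_ d ρ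
⟦ dd s t u ⟧ _∧_ d ρ = d (⟦ s ⟧ _∧_ d ρ) (⟦ t ⟧ _∧_ d ρ) (⟦ u ⟧ _∧_ d ρ)

env₂ : ∀ {a} {A : Set a} → A → A → Fin 2 → A
env₂ x y zero = x
env₂ x y (suc _) = y

env₃ : ∀ {a} {A : Set a} → A → A → A → Fin 3 → A
env₃ x y z zero = x
env₃ x y z (suc zero) = y
env₃ x y z (suc (suc _)) = z

termOp₂ : ∀ {a} {A : Set a} → Term 2 → Op₂ A → Op₃ A → Op₂ A
termOp₂ t _∧_ d x y = ⟦ t ⟧ _∧_ d (env₂ x y)

termOp₃ : ∀ {a} {A : Set a} → Term 3 → Op₂ A → Op₃ A → Op₃ A
termOp₃ t _∧_ d x y z = ⟦ t ⟧ _∧_ d (env₃ x y z)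

-- SMB algebra (A; ∧, d) over the relation ~ :
--  * ~ is a congruence of (A; ∧, d)  (equivalence + compatibility of ∧ is
--    contained in IsSemilattice; compatibility of d is d-cong),
--  * (A/~; ∧) is a semilattice  (IsSemilattice w.r.t. the equality ~),
--  * A is idempotent,
--  * on each ~-class ∧ is the second projection and d is Mal'cev.
record IsSMB {a ℓ} {A : Set a} (_∧_ : Op₂ A) (d : Op₃ A) (_~_ : Rel A ℓ)
       : Set (a ⊔ ℓ) where
  field
    quotientSemilattice : IsSemilattice _~_ _∧_
    d-cong   : ∀ {x x′ y y′ z z′} → x ~ x′ → y ~ y′ → z ~ z′ → d x y z ~ d x′ y′ z′
    ∧-idem   : ∀ x → x ∧ x ≡ x
    d-idem   : ∀ x → d x x x ≡ x
    ∧-proj₂  : ∀ {x y} → x ~ y → x ∧ y ≡ y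
    malcevˡ  : ∀ {x y} → x ~ y → d x y y ≡ x
    malcevʳ  : ∀ {x y} → x ~ y → d y y x ≡ x

ClassLeq : ∀ {a ℓ} {A : Set a} → Op₂ A → Rel A ℓ → A → A → Set ℓ
ClassLeq _∧_ _~_ u v = (u ∧ v) ~ u

{-# OPTIONS --safe #-}
-- Take x ∧′ y = (x ∧ y) ∧ y. Modulo ~ it is just x ∧ y, it is the second
-- projection on each ~-class, and it already returns y as soon as
-- [x] ≥ [y], since then x ∧ y ~ y. Let d′ x y z apply d to the three
-- "rotated meets" (y ∧′ z) ∧′ x, (x ∧′ z) ∧′ y, (x ∧′ y) ∧′ z: these all lie
-- in the class of x ∧ y ∧ z and collapse to x, y, z when x ~ y ~ z. Hence d′
-- agrees with d inside a class, and since the rotated meets of x, y, z lie in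
-- one class, d′ evaluated at them is d at them, which is d′ x y z.
module Submission where

open import Defs
open import Level using (Level)
open import Data.Product using (Σ; _×_; _,_)
open import Data.Fin using (zero; suc)
open import Relation.Binary.Core using (Rel)
open import Relation.Binary.PropositionalEquality as ≡
  using (_≡_; cong; cong₂; module ≡-Reasoning)
import Relation.Binary.Reasoning.Setoid as SetoidReasoning
open import Algebra.Core using (Op₂)
open import Algebra.Lattice.Structures using (IsSemilattice)

module _ {a ℓ} {A : Set a} {_≈_ : Rel A ℓ} {_∙_ _∘_ : Op₂ A} where

  isSemilattice-pointwise : IsSemilattice _≈_ _∙_ → (∀ x y → (x ∘ y) ≈ (x ∙ y))
                          → IsSemilattice _≈_ _∘_
  isSemilattice-pointwise L ∘≈∙ = record
    { isBand = record
      { isSemigroup = record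
        { isMagma = record { isEquivalence = isEquivalence ; ∙-cong = ∘-cong }
        ; assoc   = ∘-assoc
        }
      ; idem = λ x → trans (∘≈∙ x x) (idem x)
      }
    ; comm = λ x y → trans (∘≈∙ x y) (trans (comm x y) (sym (∘≈∙ y x)))
    }
    where
    open IsSemilattice _≈_ L
    open SetoidReasoning setoid

    ∘-cong : ∀ {x x′ y y′} → x ≈ x′ → y ≈ y′ → (x ∘ y) ≈ (x′ ∘ y′)
    ∘-cong {x} {x′} {y} {y′} p q = begin
      x ∘ y    ≈⟨ ∘≈∙ x y ⟩
      x ∙ y    ≈⟨ ∙-cong p q ⟩
      x′ ∙ y′  ≈⟨ ∘≈∙ x′ y′ ⟨
      x′ ∘ y′  ∎

    ∘-assoc : ∀ x y z → ((x ∘ y) ∘ z) ≈ (x ∘ (y ∘ z))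
    ∘-assoc x y z = begin
      (x ∘ y) ∘ z  ≈⟨ ∘≈∙ (x ∘ y) z ⟩
      (x ∘ y) ∙ z  ≈⟨ ∙-congʳ (∘≈∙ x y) ⟩
      (x ∙ y) ∙ z  ≈⟨ assoc x y z ⟩
      x ∙ (y ∙ z)  ≈⟨ ∙-congˡ (∘≈∙ y z) ⟨
      x ∙ (y ∘ z)  ≈⟨ ∘≈∙ x (y ∘ z) ⟨
      x ∘ (y ∘ z)  ∎

module SMB {a ℓ} {A : Set a} {_∧_ : Op₂ A} {d : Op₃ A} {_~_ : Rel A ℓ}
           (S : IsSMB _∧_ d _~_) where

  open IsSMB S
  open IsSemilattice _~_ quotientSemilattice
    using (refl; sym; trans; setoid; assoc; comm)

  _∧′_ : Op₂ A
  x ∧′ y = (x ∧ y) ∧ y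

  d′ : Op₃ A
  d′ x y z = d ((y ∧′ z) ∧′ x) ((x ∧′ z) ∧′ y) ((x ∧′ y) ∧′ z)

  ∧′~∧ : ∀ x y → (x ∧′ y) ~ (x ∧ y)
  ∧′~∧ x y = begin
    (x ∧ y) ∧ y  ≈⟨ assoc x y y ⟩
    x ∧ (y ∧ y)  ≡⟨ cong (x ∧_) (∧-idem y) ⟩
    x ∧ y        ∎
    where open SetoidReasoning setoid

  ∧′-isSemilattice : IsSemilattice _~_ _∧′_
  ∧′-isSemilattice = isSemilattice-pointwise quotientSemilattice ∧′~∧

  open IsSemilattice _~_ ∧′-isSemilattice using ()
    renaming (assoc to ∧′-assoc; comm to ∧′-comm; ∙-cong to ∧′-cong; ∙-congˡ to ∧′-congˡ)

  ∧′-proj₂ : ∀ {x y} → x ~ y → x ∧′ y ≡ y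
  ∧′-proj₂ {x} {y} x~y = ≡.trans (cong (_∧ y) (∧-proj₂ x~y)) (∧-idem y)

  ∧′-idem : ∀ x → x ∧′ x ≡ x
  ∧′-idem x = ∧′-proj₂ refl

  ∧′-proj₂-below : ∀ {x y} → ClassLeq _∧_ _~_ y x → x ∧′ y ≡ y
  ∧′-proj₂-below {x} {y} y≤x = ∧-proj₂ (trans (comm x y) y≤x)

  rotated-meet₁ : ∀ x y z → ((y ∧′ z) ∧′ x) ~ ((x ∧′ y) ∧′ z)
  rotated-meet₁ x y z = trans (∧′-comm (y ∧′ z) x) (sym (∧′-assoc x y z))

  rotated-meet₂ : ∀ x y z → ((x ∧′ z) ∧′ y) ~ ((x ∧′ y) ∧′ z)
  rotated-meet₂ x y z = begin
    (x ∧′ z) ∧′ y  ≈⟨ ∧′-assoc x z y ⟩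
    x ∧′ (z ∧′ y)  ≈⟨ ∧′-congˡ (∧′-comm z y) ⟩
    x ∧′ (y ∧′ z)  ≈⟨ ∧′-assoc x y z ⟨
    (x ∧′ y) ∧′ z  ∎
    where open SetoidReasoning setoid

  d′≡d : ∀ {x y z} → x ~ y → y ~ z → d′ x y z ≡ d x y z
  d′≡d {x} {y} {z} x~y y~z = begin
    d ((y ∧′ z) ∧′ x) ((x ∧′ z) ∧′ y) ((x ∧′ y) ∧′ z)
      ≡⟨ cong₂ (λ u v → d u v ((x ∧′ y) ∧′ z))
               (cong (_∧′ x) (∧′-proj₂ y~z)) (cong (_∧′ y) (∧′-proj₂ x~z)) ⟩
    d (z ∧′ x) (z ∧′ y) ((x ∧′ y) ∧′ z)
      ≡⟨ cong₂ (λ u v → d u v ((x ∧′ y) ∧′ z)) (∧′-proj₂ (sym x~z)) (∧′-proj₂ (sym y~z)) ⟩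
    d x y ((x ∧′ y) ∧′ z)
      ≡⟨ cong (λ w → d x y (w ∧′ z)) (∧′-proj₂ x~y) ⟩
    d x y (y ∧′ z)
      ≡⟨ cong (d x y) (∧′-proj₂ y~z) ⟩
    d x y z
      ∎
    where
    open ≡-Reasoning
    x~z : x ~ z
    x~z = trans x~y y~z

  d-within-class : ∀ {u v w} → u ~ v → u ~ w → d u v w ~ u
  d-within-class {u} {v} {w} u~v u~w = begin
    d u v w  ≈⟨ d-cong refl (sym u~v) (sym u~w) ⟩
    d u u u  ≡⟨ d-idem u ⟩
    u        ∎
    where open SetoidReasoning setoid

  d′~meet : ∀ x y z → d′ x y z ~ ((x ∧′ y) ∧′ z)
  d′~meet x y z = trans (d-within-class (trans r₁ (sym r₂)) r₁) r₁
    where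
    r₁ = rotated-meet₁ x y z
    r₂ = rotated-meet₂ x y z

  d′-rotated-meets : ∀ x y z → d′ x y z ≡ d′ ((y ∧′ z) ∧′ x) ((x ∧′ z) ∧′ y) ((x ∧′ y) ∧′ z)
  d′-rotated-meets x y z =
    ≡.sym (d′≡d (trans (rotated-meet₁ x y z) (sym (rotated-meet₂ x y z))) (rotated-meet₂ x y z))

  d′-cong : ∀ {x x′ y y′ z z′} → x ~ x′ → y ~ y′ → z ~ z′ → d′ x y z ~ d′ x′ y′ z′
  d′-cong p q r = d-cong (∧′-cong (∧′-cong q r) p) (∧′-cong (∧′-cong p r) q) (∧′-cong (∧′-cong p q) r)

  isSMB′ : IsSMB _∧′_ d′ _~_
  isSMB′ = record
    { quotientSemilattice = ∧′-isSemilattice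
    ; d-cong  = d′-cong
    ; ∧-idem  = ∧′-idem
    ; d-idem  = λ x → ≡.trans (d′≡d refl refl) (d-idem x)
    ; ∧-proj₂ = ∧′-proj₂
    ; malcevˡ = λ x~y → ≡.trans (d′≡d x~y refl) (malcevˡ x~y)
    ; malcevʳ = λ x~y → ≡.trans (d′≡d refl (sym x~y)) (malcevʳ x~y)
    }

∧′-term : Term 2
∧′-term = meet (meet x y) y
  where
  x y : Term 2
  x = var zero
  y = var (suc zero)

d′-term : Term 3
d′-term = dd ((y ∧′ z) ∧′ x) ((x ∧′ z) ∧′ y) ((x ∧′ y) ∧′ z)
  where
  x y z : Term 3
  x = var zero
  y = var (suc zero)
  z = var (suc (suc zero))
  _∧′_ : Term 3 → Term 3 → Term 3
  s ∧′ t = meet (meet s t) t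

proposition5p3 : ∀ {a ℓ : Level} {A : Set a} (_∧_ : Op₂ A) (d : Op₃ A) (_~_ : Rel A ℓ)
    → IsSMB _∧_ d _~_
    → Σ (Term 3) λ d′t → Σ (Term 2) λ m′t →
        let _∧′_ = termOp₂ m′t _∧_ d
            d′ = termOp₃ d′t _∧_ d
        in IsSMB _∧′_ d′ _~_
           × (∀ a b c → a ~ b → b ~ c → d′ a b c ≡ d a b c)
           × (∀ a b c → d′ a b c ~ ((a ∧′ b) ∧′ c))
           × (∀ a b → ClassLeq _∧_ _~_ b a → a ∧′ b ≡ b)
           × (∀ x y z → d′ x y z ≡ d′ ((y ∧′ z) ∧′ x) ((x ∧′ z) ∧′ y) ((x ∧′ y) ∧′ z))
proposition5p3 _∧_ d _~_ S =
  d′-term , ∧′-term , isSMB′ , (λ _ _ _ → d′≡d) , d′~meet , (λ _ _ → ∧′-proj₂-below) , d′-rotated-meets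
  where open SMB S
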